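{- Let $G$ be a graph, $s,t\in V(G)$, and let $S,T\subseteq V(G)$ satisfy: $s\in S$, $t\in T$, $S\cap T=\emptyset$, $G[S]$ and $G[T]$ are connected, and there is no edge between $S$ and $T$. Suppose $v\in N(S)$ is such that either there is no path from $v$ to any vertex of $T$, or every path from $v$ to a vertex of $T$ contains a vertex of $N(S)\setminus\{v\}$. Then no minimal $ST$-separator of $G$ that is disjoint from $S\cup T$ contains $v$. The symmetric statement holds with the roles of $S$ and $T$ exchanged.
   Context: All graphs are finite, simple and undirected. For $X\subseteq V(G)$, $N(X)$ denotes the set of vertices not in $X$ with a neighbour in $X$. An $ST$-separator is a set $Z\subseteq V(G)$ such that $G-Z$ has no path from a vertex of $S$ to a vertex of $T$; it is minimal if no proper subset is an $ST$-separator. -}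

module Defs where

open import Data.Nat using (ℕ)
open import Data.Fin using (Fin)
open import Data.Bool using (Bool; true; false)
open import Data.List using (List; []; _∷_)
open import Data.List.Relation.Unary.All using (All)
open import Data.List.Relation.Unary.Any using (Any)
open import Data.List.Relation.Unary.Unique.Propositional using (Unique)
open import Data.Fin.Subset using (Subset; _∈_; _∉_; _⊂_)
open import Data.Product using (Σ; ∃; ∃-syntax; _×_; _,_)
open import Data.Sum using (_⊎_)
open import Relation.Nullary using (¬_)
open import Relation.Binary.PropositionalEquality using (_≡_; _≢_)

record Graph (n : ℕ) : Set where
  field
    adj      : Fin n → Fin n → Bool
    adj-sym  : ∀ u v → adj u v ≡ adj v u
    adj-irr  : ∀ v → adj v v ≡ false

module _ {n : ℕ} (G : Graph n) where
  open Graph G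

  Edge : Fin n → Fin n → Set
  Edge u v = adj u v ≡ true

  data Walk : Fin n → Fin n → Set where
    [_]  : (v : Fin n) → Walk v v
    _∷⟨_⟩_ : (u : Fin n) {w v : Fin n} → Edge u w → Walk w v → Walk u v

  vertices : ∀ {u v} → Walk u v → List (Fin n)
  vertices [ v ] = v ∷ []
  vertices (u ∷⟨ _ ⟩ p) = u ∷ vertices p

  IsPath : ∀ {u v} → Walk u v → Set
  IsPath p = Unique (vertices p)

  N : Subset n → Fin n → Set
  N X x = x ∉ X × ∃[ y ] (y ∈ X × Edge x y)

  Connected : Subset n → Set
  Connected X = ∀ a b → a ∈ X → b ∈ X →
    Σ (Walk a b) λ p → IsPath p × All (_∈ X) (vertices p)

  PathAvoiding : Subset n → Subset n → Subset n → Set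
  PathAvoiding S T Z = ∃[ a ] ∃[ b ] (a ∈ S × b ∈ T ×
    Σ (Walk a b) λ p → IsPath p × All (_∉ Z) (vertices p))

  Separator : Subset n → Subset n → Subset n → Set
  Separator S T Z = ¬ PathAvoiding S T Z

  MinimalSeparator : Subset n → Subset n → Subset n → Set
  MinimalSeparator S T Z =
    Separator S T Z × (∀ Z′ → Z′ ⊂ Z → ¬ Separator S T Z′)

  GoodPair : Fin n → Fin n → Subset n → Subset n → Set
  GoodPair s t S T =
    s ∈ S × t ∈ T × (∀ x → x ∈ S → x ∉ T) ×
    Connected S × Connected T ×
    (∀ a b → a ∈ S → b ∈ T → ¬ Edge a b)

  Condition : Subset n → Subset n → Fin n → Set
  Condition X Y v = N X v ×
    ( (¬ (∃[ y ] (y ∈ Y × Σ (Walk v y) IsPath)))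
    ⊎ (∀ y → y ∈ Y → (p : Walk v y) → IsPath p →
         Any (λ x → N X x × x ≢ v) (vertices p)))

  NotInMinSep : Subset n → Subset n → Fin n → Set
  NotInMinSep S T v = ∀ Z → MinimalSeparator S T Z →
    (∀ x → x ∈ Z → x ∉ S × x ∉ T) → v ∉ Z

{-# OPTIONS --safe #-}
-- Suppose Z is a minimal ST-separator missing S ∪ T and v ∈ Z. By minimality
-- Z - v is no separator, so some S–T path P avoids Z - v, and P must pass
-- through v. The part of P from v to T is a path from v to T, hence by
-- hypothesis it meets some x ∈ N(S) other than v; the part of P from x on
-- avoids v and therefore all of Z. Prefixing a neighbour of x in S (which lies
-- outside Z) yields an S–T path avoiding Z, a contradiction. Exchanging S and
-- T only requires reversing paths.
module Submission where

open import Defs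
open import Data.Nat using (ℕ; suc)
open import Data.Fin using (Fin; _≟_)
open import Data.Fin.Subset using (Subset; _∈_; _∉_; _-_)
open import Data.Fin.Subset.Properties using (x∈p∧x≢y⇒x∈p-y; x∈p⇒p-x⊂p)
open import Data.Product using (_×_; _,_; proj₁; proj₂; Σ; ∃-syntax; uncurry)
open import Data.Sum using (inj₁; inj₂)
open import Data.List as List using (_∷_; drop; _∷ʳ_)
open import Data.List.Properties using (unfold-reverse)
open import Data.List.Relation.Unary.All as All using (All; _∷_)
import Data.List.Relation.Unary.All.Properties as All
open import Data.List.Relation.Unary.All.Properties.Core using (¬Any⇒All¬)
open import Data.List.Relation.Unary.Any using (here; there; any?)
open import Data.List.Relation.Unary.AllPairs using (_∷_)
import Data.List.Relation.Unary.Unique.Propositional.Properties as Unique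
open import Data.List.Membership.Propositional using (find) renaming (_∈_ to _∈ᵥ_)
open import Data.List.Relation.Unary.Unique.Propositional using (Unique)
import Data.List.Relation.Binary.Permutation.Setoid as Permutation
import Data.List.Relation.Binary.Permutation.Setoid.Properties as Permutationₚ
open import Relation.Nullary using (yes; no; contradiction)
open import Relation.Binary.PropositionalEquality using (_≡_; _≢_; ≢-sym; refl; sym; trans; cong; subst; setoid;
  module ≡-Reasoning)

module _ {n : ℕ} {p : Subset n} {y : Fin n} where

  ∉-minus : ∀ {x} → x ∉ p - y → y ≢ x → x ∉ p
  ∉-minus x∉p-y y≢x x∈p = x∉p-y (x∈p∧x≢y⇒x∈p-y x∈p (≢-sym y≢x))

  All-∉-minus : ∀ {xs} → All (_∉ p - y) xs → All (y ≢_) xs → All (_∉ p) xs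
  All-∉-minus avoids y∉xs = All.zipWith (uncurry ∉-minus) (avoids , y∉xs)

module _ {n : ℕ} (G : Graph n) where
  open Permutation (setoid (Fin n)) using (↭-sym)
  open Permutationₚ (setoid (Fin n)) using (↭-reverse; Unique-resp-↭; All-resp-↭)

  Edge-sym : ∀ {u w} → Edge G u w → Edge G w u
  Edge-sym {u} {w} e = trans (Graph.adj-sym G w u) e

  snoc : ∀ {u w x} → Walk G u w → Edge G w x → Walk G u x
  snoc [ w ] e = w ∷⟨ e ⟩ [ _ ]
  snoc (u ∷⟨ e′ ⟩ p) e = u ∷⟨ e′ ⟩ snoc p e

  vertices-snoc : ∀ {u w x} (p : Walk G u w) (e : Edge G w x) →
    vertices G (snoc p e) ≡ vertices G p ∷ʳ x
  vertices-snoc [ w ] e = refl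
  vertices-snoc (u ∷⟨ e′ ⟩ p) e = cong (u ∷_) (vertices-snoc p e)

  reverse : ∀ {u v} → Walk G u v → Walk G v u
  reverse [ v ] = [ v ]
  reverse (u ∷⟨ e ⟩ p) = snoc (reverse p) (Edge-sym e)

  vertices-reverse : ∀ {u v} (p : Walk G u v) →
    vertices G (reverse p) ≡ List.reverse (vertices G p)
  vertices-reverse [ v ] = refl
  vertices-reverse (u ∷⟨ e ⟩ p) = begin
    vertices G (snoc (reverse p) (Edge-sym e))  ≡⟨ vertices-snoc (reverse p) (Edge-sym e) ⟩
    vertices G (reverse p) ∷ʳ u                 ≡⟨ cong (_∷ʳ u) (vertices-reverse p) ⟩
    List.reverse (vertices G p) ∷ʳ u            ≡⟨ sym (unfold-reverse u (vertices G p)) ⟩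
    List.reverse (u ∷ vertices G p)             ∎
    where open ≡-Reasoning

  PathWithin : (Fin n → Set) → Fin n → Fin n → Set
  PathWithin P a b = Σ (Walk G a b) λ p → IsPath G p × All P (vertices G p)

  PathWithin-reverse : ∀ {P a b} → PathWithin P a b → PathWithin P b a
  PathWithin-reverse {P} (p , p-path , p-within) =
    reverse p ,
    subst Unique (sym (vertices-reverse p)) (Unique-resp-↭ reverse↭ p-path) ,
    subst (All P) (sym (vertices-reverse p)) (All-resp-↭ (subst P) reverse↭ p-within)
    where reverse↭ = ↭-sym (↭-reverse (vertices G p))

  PathAvoiding-swap : ∀ {S T Z} → PathAvoiding G S T Z → PathAvoiding G T S Z
  PathAvoiding-swap (a , b , a∈S , b∈T , π) = b , a , b∈T , a∈S , PathWithin-reverse π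

  Separator-swap : ∀ {S T Z} → Separator G S T Z → Separator G T S Z
  Separator-swap sep π = sep (PathAvoiding-swap π)

  suffixFrom : ∀ {u b x} (p : Walk G u b) → x ∈ᵥ vertices G p →
    ∃[ k ] Σ (Walk G x b) λ q → vertices G q ≡ drop k (vertices G p)
  suffixFrom [ v ] (here refl) = 0 , [ v ] , refl
  suffixFrom p@(_ ∷⟨ _ ⟩ _) (here refl) = 0 , p , refl
  suffixFrom (u ∷⟨ e ⟩ p) (there x∈p) with suffixFrom p x∈p
  ... | k , q , q≡ = suc k , q , q≡

  PathWithin-suffix : ∀ {P u b x} ((p , _) : PathWithin P u b) → x ∈ᵥ vertices G p →
    PathWithin P x b
  PathWithin-suffix {P} (p , p-path , p-within) x∈p with suffixFrom p x∈p
  ... | k , q , q≡ =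
    q , subst Unique (sym q≡) (Unique.drop⁺ k p-path) ,
    subst (All P) (sym q≡) (All.drop⁺ k p-within)

  PathWithin-prepend : ∀ {P x y b} → Edge G y x → P y → PathWithin P x b → PathWithin P y b
  PathWithin-prepend {y = y} e Py π@(p , p-path , p-within) with any? (y ≟_) (vertices G p)
  ... | yes y∈p = PathWithin-suffix π y∈p
  ... | no  y∉p = y ∷⟨ e ⟩ p , ¬Any⇒All¬ _ y∉p ∷ p-path , Py ∷ p-within

  -- A path from v visits v only at its start, so every later suffix avoids v.
  PathWithin-suffix-minus-start : ∀ {Z v b x} ((q , _) : PathWithin (_∉ Z - v) v b) →
    x ∈ᵥ vertices G q → x ≢ v → PathWithin (_∉ Z) x b
  PathWithin-suffix-minus-start ([ _ ] , _) (here x≡v) x≢v = contradiction x≡v x≢v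
  PathWithin-suffix-minus-start (_ ∷⟨ _ ⟩ _ , _) (here x≡v) x≢v = contradiction x≡v x≢v
  PathWithin-suffix-minus-start (_ ∷⟨ _ ⟩ q , v∉q ∷ q-path , _ ∷ q-within) (there x∈q) _ =
    PathWithin-suffix (q , q-path , All-∉-minus q-within v∉q) x∈q

  N⇒PathAvoiding : ∀ {S T Z x b} → (∀ y → y ∈ S → y ∉ Z) → N G S x →
    PathWithin (_∉ Z) x b → b ∈ T → PathAvoiding G S T Z
  N⇒PathAvoiding S∩Z≡∅ (_ , y , y∈S , x~y) π b∈T =
    y , _ , y∈S , b∈T , PathWithin-prepend (Edge-sym x~y) (S∩Z≡∅ y y∈S) π

  Condition⇒Separator-minus : ∀ {S T Z v} → Condition G S T v → (∀ y → y ∈ S → y ∉ Z) →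
    Separator G S T Z → Separator G S T (Z - v)
  Condition⇒Separator-minus {v = v} (_ , v↝T) S∩Z≡∅ sep
    (a , b , a∈S , b∈T , π@(p , p-path , p-within)) with any? (v ≟_) (vertices G p)
  ... | no v∉p = sep (a , b , a∈S , b∈T , p , p-path , All-∉-minus p-within (¬Any⇒All¬ _ v∉p))
  ... | yes v∈p with PathWithin-suffix π v∈p | v↝T
  ...   | q , q-path , _ | inj₁ no-path = no-path (b , b∈T , q , q-path)
  ...   | σ@(q , q-path , _) | inj₂ meets-N with find (meets-N b b∈T q q-path)
  ...     | x , x∈q , x∈N , x≢v =
    sep (N⇒PathAvoiding S∩Z≡∅ x∈N (PathWithin-suffix-minus-start σ x∈q x≢v) b∈T)

  NotInMinSep-intro : ∀ {S T v} →
    (∀ Z → (∀ x → x ∈ Z → x ∉ S × x ∉ T) → Separator G S T Z → Separator G S T (Z - v)) →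
    NotInMinSep G S T v
  NotInMinSep-intro {v = v} removable Z (sep , minimal) Z∩[S∪T]≡∅ v∈Z =
    minimal (Z - v) (x∈p⇒p-x⊂p v∈Z) (removable Z Z∩[S∪T]≡∅ sep)

lemma9 : ∀ {n : ℕ} (G : Graph n) (s t : Fin n) (S T : Subset n) →
    GoodPair G s t S T →
    (∀ v → Condition G S T v → NotInMinSep G S T v) ×
    (∀ v → Condition G T S v → NotInMinSep G S T v)
lemma9 G s t S T _ =
  (λ v S-condition → NotInMinSep-intro G λ Z Z∩[S∪T]≡∅ →
     Condition⇒Separator-minus G S-condition (λ x x∈S x∈Z → proj₁ (Z∩[S∪T]≡∅ x x∈Z) x∈S)) ,
  (λ v T-condition → NotInMinSep-intro G λ Z Z∩[S∪T]≡∅ sep →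
     Separator-swap G (Condition⇒Separator-minus G T-condition
       (λ x x∈T x∈Z → proj₂ (Z∩[S∪T]≡∅ x x∈Z) x∈T) (Separator-swap G sep)))
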